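{- Let $G$ be a finite simple undirected graph (no weights) in which every edge belongs to a cycle of length three. Then there exist an orientation of the edges of $G$, a colour function $\Xi:A(G)\to\mathbb{Z}_2^3$ and a weight function on the resulting arrows such that the resulting digraph, equipped with them, is the union digraph of at least one finite-dimensional algebra over $\mathbb{F}$ with respect to some basis.
   Context: $\mathbb{F}$ is an algebraically closed field of characteristic zero; an algebra is a finite-dimensional $\mathbb{F}$-vector space with bilinear product $*$; for a basis $\{e_1,\dots,e_n\}$ write $e_i*e_j=\sum_k c_{ij}^k e_k$. The operands digraph $G_O(A)$ has an arrow $e_i\to e_j$ iff $e_i*e_j\ne0$; $G_R(A)$ has an arrow $e_i\to e_k$ iff $c_{ij}^k\ne0$ for some $j$; $G_L(A)$ has an arrow $e_j\to e_k$ iff $c_{ij}^k\ne0$ for some $i$. The union digraph $G_U(A)$ has vertices $e_1,\dots,e_n$, arrow set the union of the arrow sets of $G_O(A),G_R(A),G_L(A)$, colour $\Xi(\alpha)\in\mathbb{Z}_2^3$ whose three coordinates indicate membership of $\alpha$ in $G_O(A),G_R(A),G_L(A)$ respectively, and weight in $\mathbb{F}^{3n}$ formed from the weights of the arrow in these three digraphs (zero where absent); the weight of $e_i\to e_k$ in $G_R(A)$ is $(c_{ij}^k)_j$, of $e_j\to e_k$ in $G_L(A)$ is $(c_{ij}^k)_i$, of $e_i\to e_j$ in $G_O(A)$ is $(c_{ij}^k)_k$. -}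

module Defs where

open import Level using (Level; _⊔_)
open import Algebra.Bundles using (CommutativeRing)
open import Data.Nat using (ℕ; zero; suc; _≤_)
open import Data.Fin using (Fin)
open import Data.Bool using (Bool; true; false; T)
open import Data.List using (List; []; _∷_; _++_; [_]; length)
open import Data.Product using (Σ; ∃; ∃-syntax; _×_; _,_)
open import Relation.Nullary using (¬_)
open import Relation.Binary.PropositionalEquality using (_≡_)
open import Function.Bundles using (_⇔_)
open import Data.Sum using (_⊎_)
open import Data.Empty using (⊥)

module _ {c ℓ : Level} (R : CommutativeRing c ℓ) where
  open CommutativeRing R

  natCast : ℕ → Carrier
  natCast zero    = 0#
  natCast (suc n) = 1# + natCast n

  -- evaluation of a polynomial given by its coefficient list a₀ ∷ a₁ ∷ …
  -- (lowest degree first), via Horner's rule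
  evalPoly : List Carrier → Carrier → Carrier
  evalPoly []       x = 0#
  evalPoly (a ∷ as) x = a + x * evalPoly as x

  record IsAlgClosedFieldChar0 : Set (c ⊔ ℓ) where
    field
      nontrivial  : ¬ (1# ≈ 0#)
      inverse     : ∀ x → ¬ (x ≈ 0#) → ∃[ y ] (x * y ≈ 1#)
      charZero    : ∀ n → ¬ (natCast (suc n) ≈ 0#)
      -- every polynomial  as ++ [ a ]  of degree length as ≥ 1 with
      -- nonzero leading coefficient a has a root
      algClosed   : ∀ (as : List Carrier) (a : Carrier) →
                    ¬ (a ≈ 0#) → 1 ≤ length as →
                    ∃[ x ] (evalPoly (as ++ [ a ]) x ≈ 0#)

record SimpleGraph (n : ℕ) : Set where
  field
    adj       : Fin n → Fin n → Bool
    symmetric : ∀ i j → adj i j ≡ adj j i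
    loopless  : ∀ i → adj i i ≡ false

EveryEdgeInTriangle : ∀ {n} → SimpleGraph n → Set
EveryEdgeInTriangle {n} G =
  ∀ i j → T (adj i j) → ∃[ k ] (T (adj i k) × T (adj j k))
  where open SimpleGraph G

record Orientation {n} (G : SimpleGraph n) : Set where
  open SimpleGraph G
  field
    arrow    : Fin n → Fin n → Bool
    fromEdge : ∀ i j → T (arrow i j) → T (adj i j)
    someDir  : ∀ i j → T (adj i j) → T (arrow i j) ⊎ T (arrow j i)
    notBoth  : ∀ i j → T (arrow i j) → T (arrow j i) → ⊥

-- Algebras of dimension n over F, given by a basis e₀,…,e_{n-1} and
-- structure constants  e_i * e_j = Σ_k c i j k · e_k ,
-- and their union digraph.

Colour : Set
Colour = Bool × Bool × Bool

module _ {c ℓ : Level} (F : CommutativeRing c ℓ) where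
  open CommutativeRing F

  StructureConstants : ℕ → Set c
  StructureConstants n = Fin n → Fin n → Fin n → Carrier

  -- weights of the union digraph: elements of F^{3n} = F^n × F^n × F^n
  -- (components coming from G_O, G_R, G_L respectively)
  Weight : ℕ → Set c
  Weight n = (Fin n → Carrier) × (Fin n → Carrier) × (Fin n → Carrier)

  module _ {n : ℕ} (γ : StructureConstants n) where

    OArrow : Fin n → Fin n → Set ℓ
    OArrow i j = ∃[ k ] ¬ (γ i j k ≈ 0#)

    RArrow : Fin n → Fin n → Set ℓ
    RArrow i k = ∃[ j ] ¬ (γ i j k ≈ 0#)

    LArrow : Fin n → Fin n → Set ℓ
    LArrow j k = ∃[ i ] ¬ (γ i j k ≈ 0#)

    UArrow : Fin n → Fin n → Set ℓ
    UArrow a b = OArrow a b ⊎ RArrow a b ⊎ LArrow a b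

    ColourIs : Fin n → Fin n → Colour → Set ℓ
    ColourIs a b (x , y , z) =
      (T x ⇔ OArrow a b) × (T y ⇔ RArrow a b) × (T z ⇔ LArrow a b)

    _≋_ : (Fin n → Carrier) → (Fin n → Carrier) → Set ℓ
    u ≋ v = ∀ m → u m ≈ v m

    zeroVec : Fin n → Carrier
    zeroVec _ = 0#

    WeightIs : Fin n → Fin n → Weight n → Set ℓ
    WeightIs a b (wO , wR , wL) =
      ((OArrow a b → wO ≋ (λ k → γ a b k)) × (¬ OArrow a b → wO ≋ zeroVec)) ×
      ((RArrow a b → wR ≋ (λ j → γ a j b)) × (¬ RArrow a b → wR ≋ zeroVec)) ×
      ((LArrow a b → wL ≋ (λ i → γ i a b)) × (¬ LArrow a b → wL ≋ zeroVec))

    IsUnionDigraph : (Fin n → Fin n → Bool) → (Fin n → Fin n → Colour) →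
                     (Fin n → Fin n → Weight n) → Set ℓ
    IsUnionDigraph arrow Ξ w =
      (∀ a b → T (arrow a b) ⇔ UArrow a b) ×
      (∀ a b → T (arrow a b) → ColourIs a b (Ξ a b) × WeightIs a b (w a b))

-- Number the vertices and orient every edge from the smaller to the larger
-- endpoint.  Take the algebra with e_i * e_j = e_k exactly when i < j < k span a
-- triangle of G, and all other products zero.  Its arrows a → b (in G_O, G_R
-- or G_L) are then the pairs a < b lying on a common triangle, and since every
-- edge lies on a triangle these are exactly the oriented edges of G.  Colours
-- and weights are read off the structure constants, which is possible because
-- they are all 0 or 1, so being zero is decidable.
module Submission where

open import Defs
open import Level using (Level)
open import Algebra.Bundles using (CommutativeRing)
open import Data.Nat using (ℕ)
open import Data.Fin using (Fin)
open import Data.Product using (Σ; ∃; ∃-syntax; _×_; _,_)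

open import Data.Fin using (_<_)
open import Data.Fin.Properties using (_<?_; <-cmp; <-asym; <-trans; any?)
open import Data.Bool using (Bool; T; _∧_)
open import Data.Bool.Properties using (T?; T-∧)
open import Data.Product using (map₂; proj₁; proj₂)
open import Data.Product.Function.NonDependent.Propositional using (_×-cong_)
open import Data.Sum using (_⊎_; inj₁; inj₂)
open import Data.Sum.Function.Propositional using (_⊎-cong_)
open import Data.Unit using (tt)
open import Function using (const)
open import Function.Bundles using (_⇔_; mk⇔; Equivalence)
open import Function.Construct.Composition using (_⇔-∘_)
open import Function.Construct.Identity using (⇔-id)
open import Function.Construct.Symmetry using (⇔-sym)
open import Relation.Binary.Definitions using (tri<; tri≈; tri>)
open import Relation.Binary.PropositionalEquality as ≡ using (_≢_; subst)
open import Relation.Nullary using (¬_; Dec; yes; no; does; ¬?; contradiction)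
open import Relation.Nullary.Decidable using (_×-dec_; decidable-stable)

T-does⇔ : ∀ {p} {P : Set p} (P? : Dec P) → T (does P?) ⇔ P
T-does⇔ (yes p)  = mk⇔ (const p) (const tt)
T-does⇔ (no ¬p) = mk⇔ (λ ()) ¬p

∃-cong⇔ : ∀ {a p q} {A : Set a} {P : A → Set p} {Q : A → Set q} →
          (∀ x → P x ⇔ Q x) → ∃ P ⇔ ∃ Q
∃-cong⇔ P⇔Q = mk⇔ (map₂ (Equivalence.to (P⇔Q _))) (map₂ (Equivalence.from (P⇔Q _)))

module _ {c ℓ : Level} (F : CommutativeRing c ℓ) where
  open CommutativeRing F

  module Canonical {n : ℕ} (γ : StructureConstants F n)
                   (γ≈0? : ∀ i j k → Dec (γ i j k ≈ 0#)) where

    canonicalColour : Fin n → Fin n → Colour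
    canonicalColour a b =
      does (any? λ k → ¬? (γ≈0? a b k)) ,
      does (any? λ j → ¬? (γ≈0? a j b)) ,
      does (any? λ i → ¬? (γ≈0? i a b))

    canonicalWeight : Fin n → Fin n → Weight F n
    canonicalWeight a b = (λ k → γ a b k) , (λ j → γ a j b) , (λ i → γ i a b)

    colourIs-canonical : ∀ a b → ColourIs F γ a b (canonicalColour a b)
    colourIs-canonical a b =
      T-does⇔ (any? λ k → ¬? (γ≈0? a b k)) ,
      T-does⇔ (any? λ j → ¬? (γ≈0? a j b)) ,
      T-does⇔ (any? λ i → ¬? (γ≈0? i a b))

    slice-weight : (f : Fin n → Carrier) → (∀ m → Dec (f m ≈ 0#)) →
                   (∃[ m ] ¬ (f m ≈ 0#) → ∀ m → f m ≈ f m) ×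
                   (¬ (∃[ m ] ¬ (f m ≈ 0#)) → ∀ m → f m ≈ 0#)
    slice-weight f f≈0? =
      (λ _ _ → refl) , λ ¬∃ m → decidable-stable (f≈0? m) (λ f≉0 → ¬∃ (m , f≉0))

    weightIs-canonical : ∀ a b → WeightIs F γ a b (canonicalWeight a b)
    weightIs-canonical a b =
      slice-weight (λ k → γ a b k) (γ≈0? a b) ,
      slice-weight (λ j → γ a j b) (λ j → γ≈0? a j b) ,
      slice-weight (λ i → γ i a b) (λ i → γ≈0? i a b)

    isUnionDigraph-canonical : (arrow : Fin n → Fin n → Bool) →
                               (∀ a b → T (arrow a b) ⇔ UArrow F γ a b) →
                               IsUnionDigraph F γ arrow canonicalColour canonicalWeight
    isUnionDigraph-canonical arrow arrow⇔U =
      arrow⇔U , λ a b _ → colourIs-canonical a b , weightIs-canonical a b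

  module Indicator (1≉0 : ¬ (1# ≈ 0#)) {n p} {Δ : Fin n → Fin n → Fin n → Set p}
                   (Δ? : ∀ i j k → Dec (Δ i j k)) where

    fromDec : ∀ {q} {Q : Set q} → Dec Q → Carrier
    fromDec (yes _) = 1#
    fromDec (no _)  = 0#

    fromDec-≉0⇔ : ∀ {q} {Q : Set q} (Q? : Dec Q) → (¬ (fromDec Q? ≈ 0#)) ⇔ Q
    fromDec-≉0⇔ (yes q)  = mk⇔ (const q) (const 1≉0)
    fromDec-≉0⇔ (no ¬q) = mk⇔ (λ ≉0 → contradiction refl ≉0) (λ q → contradiction q ¬q)

    fromDec-≈0? : ∀ {q} {Q : Set q} (Q? : Dec Q) → Dec (fromDec Q? ≈ 0#)
    fromDec-≈0? (yes _) = no 1≉0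
    fromDec-≈0? (no _)  = yes refl

    indicator : StructureConstants F n
    indicator i j k = fromDec (Δ? i j k)

    indicator-≈0? : ∀ i j k → Dec (indicator i j k ≈ 0#)
    indicator-≈0? i j k = fromDec-≈0? (Δ? i j k)

    uArrow-indicator⇔ : ∀ a b →
      UArrow F indicator a b ⇔ (∃[ k ] Δ a b k ⊎ ∃[ j ] Δ a j b ⊎ ∃[ i ] Δ i a b)
    uArrow-indicator⇔ a b =
      ∃-cong⇔ (λ k → fromDec-≉0⇔ (Δ? a b k)) ⊎-cong
      ∃-cong⇔ (λ j → fromDec-≉0⇔ (Δ? a j b)) ⊎-cong
      ∃-cong⇔ (λ i → fromDec-≉0⇔ (Δ? i a b))

module _ {n : ℕ} (G : SimpleGraph n) where
  open SimpleGraph G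

  adj-sym : ∀ {i j} → T (adj i j) → T (adj j i)
  adj-sym {i} {j} = subst T (symmetric i j)

  adj⇒≢ : ∀ {i j} → T (adj i j) → i ≢ j
  adj⇒≢ {i} ii ≡.refl = subst T (loopless i) ii

  AscendingEdge : Fin n → Fin n → Set
  AscendingEdge a b = a < b × T (adj a b)

  ascendingArrow : Fin n → Fin n → Bool
  ascendingArrow a b = does (a <? b) ∧ adj a b

  T-ascendingArrow⇔ : ∀ a b → T (ascendingArrow a b) ⇔ AscendingEdge a b
  T-ascendingArrow⇔ a b = (T-does⇔ (a <? b) ×-cong ⇔-id _) ⇔-∘ T-∧

  ascending : Orientation G
  ascending = record
    { arrow    = ascendingArrow
    ; fromEdge = λ a b a→b → proj₂ (to a b a→b)
    ; someDir  = someDir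
    ; notBoth  = λ a b a→b b→a → <-asym (proj₁ (to a b a→b)) (proj₁ (to b a b→a))
    }
    where
    to : ∀ a b → T (ascendingArrow a b) → AscendingEdge a b
    to a b = Equivalence.to (T-ascendingArrow⇔ a b)

    someDir : ∀ a b → T (adj a b) → T (ascendingArrow a b) ⊎ T (ascendingArrow b a)
    someDir a b ab with <-cmp a b
    ... | tri< a<b _ _ = inj₁ (Equivalence.from (T-ascendingArrow⇔ a b) (a<b , ab))
    ... | tri≈ _ a≡b _ = contradiction a≡b (adj⇒≢ ab)
    ... | tri> _ _ b<a = inj₂ (Equivalence.from (T-ascendingArrow⇔ b a) (b<a , adj-sym ab))

  IncreasingTriangle : Fin n → Fin n → Fin n → Set
  IncreasingTriangle i j k = (i < j × j < k) × T (adj i j) × T (adj i k) × T (adj j k)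

  increasingTriangle? : ∀ i j k → Dec (IncreasingTriangle i j k)
  increasingTriangle? i j k =
    ((i <? j) ×-dec (j <? k)) ×-dec T? (adj i j) ×-dec T? (adj i k) ×-dec T? (adj j k)

  EdgeOfIncreasingTriangle : Fin n → Fin n → Set
  EdgeOfIncreasingTriangle a b =
    ∃[ k ] IncreasingTriangle a b k ⊎ ∃[ j ] IncreasingTriangle a j b ⊎ ∃[ i ] IncreasingTriangle i a b

  edgeOfIncreasingTriangle⇒ascendingEdge : ∀ {a b} → EdgeOfIncreasingTriangle a b → AscendingEdge a b
  edgeOfIncreasingTriangle⇒ascendingEdge (inj₁ (_ , (a<b , _) , ab , _))              = a<b , ab
  edgeOfIncreasingTriangle⇒ascendingEdge (inj₂ (inj₁ (_ , (a<j , j<b) , _ , ab , _))) = <-trans a<j j<b , ab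
  edgeOfIncreasingTriangle⇒ascendingEdge (inj₂ (inj₂ (_ , (_ , a<b) , _ , _ , ab)))  = a<b , ab

  ascendingEdge⇒edgeOfIncreasingTriangle : EveryEdgeInTriangle G →
    ∀ {a b} → AscendingEdge a b → EdgeOfIncreasingTriangle a b
  ascendingEdge⇒edgeOfIncreasingTriangle inTriangle {a} {b} (a<b , ab)
    with inTriangle a b ab
  ... | k , ak , bk with <-cmp k a | <-cmp k b
  ...   | tri≈ _ k≡a _ | _           = contradiction (≡.sym k≡a) (adj⇒≢ ak)
  ...   | _           | tri≈ _ k≡b _ = contradiction (≡.sym k≡b) (adj⇒≢ bk)
  ...   | tri< k<a _ _ | _           = inj₂ (inj₂ (k , (k<a , a<b) , adj-sym ak , adj-sym bk , ab))
  ...   | tri> _ _ a<k | tri< k<b _ _ = inj₂ (inj₁ (k , (a<k , k<b) , ak , ab , adj-sym bk))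
  ...   | tri> _ _ _   | tri> _ _ b<k = inj₁ (k , (a<b , b<k) , ab , ak , bk)

  ascendingEdge⇔edgeOfIncreasingTriangle : EveryEdgeInTriangle G →
    ∀ a b → AscendingEdge a b ⇔ EdgeOfIncreasingTriangle a b
  ascendingEdge⇔edgeOfIncreasingTriangle inTriangle a b =
    mk⇔ (ascendingEdge⇒edgeOfIncreasingTriangle inTriangle) edgeOfIncreasingTriangle⇒ascendingEdge

corollary5p4 : ∀ {c ℓ : Level} (F : CommutativeRing c ℓ) → IsAlgClosedFieldChar0 F →
    ∀ {n : ℕ} (G : SimpleGraph n) → EveryEdgeInTriangle G →
    Σ (Orientation G) λ o →
    Σ (Fin n → Fin n → Colour) λ Ξ →
    Σ (Fin n → Fin n → Weight F n) λ w →
    ∃[ γ ] IsUnionDigraph F γ (Orientation.arrow o) Ξ w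
corollary5p4 F isField G inTriangle =
  ascending G , canonicalColour , canonicalWeight , indicator ,
  isUnionDigraph-canonical (ascendingArrow G) arrow⇔U
  where
  open Indicator F (IsAlgClosedFieldChar0.nontrivial isField) (increasingTriangle? G)
  open Canonical F indicator indicator-≈0?

  arrow⇔U : ∀ a b → T (ascendingArrow G a b) ⇔ UArrow F indicator a b
  arrow⇔U a b =
    ⇔-sym (uArrow-indicator⇔ a b)
    ⇔-∘ (ascendingEdge⇔edgeOfIncreasingTriangle G inTriangle a b ⇔-∘ T-ascendingArrow⇔ G a b)
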